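{- For every integer $d\ge 2$, $\gamma(cDB(d,1,3))=d\lceil d/2\rceil$.
   Context: Let $[d]=\{1,\dots,d\}$. A sequence $(x_1,\dots,x_n)\in[d]^n$ is $t$-constrained if for all $1\le i<j\le n$ with $x_i=x_j$ one has $j-i\ge t$ (every sequence is $1$-constrained). For $1\le t\le\min\{d,n\}$, $V(d,t,n)$ denotes the set of $t$-constrained sequences in $[d]^n$. The directed $t$-constrained de Bruijn graph $cDB^+(d,t,n)$ is the subgraph of the directed de Bruijn graph on $[d]^n$ (arcs $(a_1,\dots,a_n)\to(a_2,\dots,a_n,a_{n+1})$) induced by $V(d,t,n)$; $cDB(d,t,n)$ is its undirected version, obtained by ignoring arc directions and removing loops and multiple edges. In an undirected graph a vertex dominates itself and its neighbours; a dominating set is a set $S$ of vertices such that every vertex is dominated by some vertex of $S$, and $\gamma(G)$ is the minimum size of a dominating set. -}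

module Defs where

open import Data.Nat using (ℕ; suc; _≤_; _<_; _∸_)
open import Data.Fin using (Fin; toℕ)
open import Data.Vec using (Vec; lookup; tail; init)
open import Data.List using (List; length)
open import Data.List.Membership.Propositional using (_∈_)
open import Data.List.Relation.Unary.All using (All)
open import Data.List.Relation.Unary.Any using (Any)
open import Data.List.Relation.Unary.Unique.Propositional using (Unique)
open import Data.Product using (_×_; ∃)
open import Data.Sum using (_⊎_)
open import Relation.Binary.PropositionalEquality using (_≡_; _≢_)

-- Sequences in [d]^n are Vec (Fin d) n  (symbols 0..d-1 instead of 1..d).
-- x is t-constrained: x_i = x_j with i < j implies j - i ≥ t.
Constrained : ∀ {d n} → ℕ → Vec (Fin d) n → Set
Constrained {d} {n} t x =
  (i j : Fin n) → toℕ i < toℕ j → lookup x i ≡ lookup x j → t ≤ toℕ j ∸ toℕ i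

Arc : ∀ {d m} → Vec (Fin d) (suc m) → Vec (Fin d) (suc m) → Set
Arc u v = tail u ≡ init v

-- Edge of the undirected constrained de Bruijn graph cDB(d,t,n) (n = suc m):
-- both ends t-constrained, distinct (loops removed), and an arc in some direction.
Edge : ∀ {d m} → ℕ → Vec (Fin d) (suc m) → Vec (Fin d) (suc m) → Set
Edge t u v = Constrained t u × Constrained t v × u ≢ v × (Arc u v ⊎ Arc v u)

Dominates : ∀ {d m} → ℕ → Vec (Fin d) (suc m) → Vec (Fin d) (suc m) → Set
Dominates t u v = u ≡ v ⊎ Edge t u v

IsDominating : ∀ {d m} → ℕ → List (Vec (Fin d) (suc m)) → Set
IsDominating {d} {m} t S =
  All (Constrained t) S ×
  ((v : Vec (Fin d) (suc m)) → Constrained t v → Any (λ u → Dominates t u v) S)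

DominationNumber : ℕ → ℕ → ℕ → ℕ → Set
DominationNumber d t m k =
  (∃ λ (S : List (Vec (Fin d) (suc m))) → Unique S × IsDominating t S × length S ≡ k) ×
  ((S : List (Vec (Fin d) (suc m))) → IsDominating t S → k ≤ length S)

-- The d⌈d/2⌉ words (2i+1) x (2i), for i < ⌈d/2⌉ and any letter x, dominate cDB(d,1,3): a
-- word abc with b = 2i follows (2i+1) a b, and one with b = 2i+1 precedes b c (2i).
--
-- Conversely let S dominate.  For a letter b let x_b be the number of letters a such that no
-- word of S ends in ab, and y_b the number of letters c such that no word of S starts with bc.
-- A word abc such that ab is not a suffix and bc not a prefix of a word of S must lie in S;
-- counting the words of S by their middle letter this way gives
-- |S| ≥ Σ_b (d - x_b + y_b (x_b - 1)), and reading words backwards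
-- |S| ≥ Σ_b (d - y_b + x_b (y_b - 1)).  A letter with x_b = 0 contributes d to the first sum,
-- one with y_b = 0 contributes d to the second, and a mixed letter (x_b, y_b ≥ 1) at least
-- d - 1 to both.  So |S| ≥ d⌈d/2⌉ unless both kinds of full letters number less than ⌈d/2⌉,
-- which leaves a mixed letter.  Two mixed letters give 2|S| ≥ d² + 2(d - 2), which suffices.
-- With exactly one mixed letter q, d is odd and the two kinds of full letters are balanced;
-- then either every middle letter m carries ⌈d/2⌉ words of S (mq is a suffix or qm a prefix,
-- on top of the full letters), or some word zqz is forced into S and z adds one to a sum.

module Submission where

open import Defs
open import Data.Nat
  using (ℕ; zero; suc; _+_; _*_; _∸_; _≤_; _<_; _⊔_; z≤n; s≤s; s≤s⁻¹; ⌈_/2⌉; ⌊_/2⌋; _≤?_; _≟_)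
open import Data.Nat.Properties
open import Algebra.Properties.Semiring.Sum +-*-semiring
  using (sum; sum-syntax; ∑-distrib-+; ∑-comm; *-distribʳ-sum; sum-cong-≗; sum-replicate-zero)
open import Algebra.Properties.CommutativeSemigroup +-commutativeSemigroup using (xy∙z≈xz∙y)
open import Data.Bool using (if_then_else_)
open import Data.Fin using (Fin; zero; suc; combine; remQuot)
open import Data.Fin.Properties using (any?; remQuot-combine; combine-remQuot) renaming (_≟_ to _≟ᶠ_)
import Data.Fin.Properties as Finₚ
open import Data.Vec using (Vec; []; _∷_)
open import Data.Vec.Properties using (∷-injective; ∷-injectiveˡ; ∷-injectiveʳ)
import Data.Vec.Properties as Vec
open import Data.List using (List; []; _∷_; length; tabulate)
open import Data.List.Properties using (length-tabulate)
open import Data.List.Membership.Propositional using (_∈_; find; lose)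
open import Data.List.Membership.Propositional.Properties using (∈-tabulate⁺)
open import Data.List.Relation.Unary.Any using (Any; toSum)
import Data.List.Relation.Unary.Any as Any
open import Data.List.Relation.Unary.All using (universal)
open import Data.List.Relation.Unary.Unique.Propositional using (Unique)
open import Data.List.Relation.Unary.Unique.Propositional.Properties using (tabulate⁺)
open import Data.Product using (∃; _×_; _,_; proj₁; proj₂; uncurry)
import Data.Product as Product
open import Data.Sum using (_⊎_; inj₁; inj₂; [_,_]; [_,_]′)
import Data.Sum as Sum
open import Data.Empty using (⊥; ⊥-elim)
open import Function using (_∘_; id)
open import Relation.Nullary using (Dec; yes; no; does; ¬_; contradiction)
open import Relation.Nullary.Decidable using (¬?; _×-dec_; _⊎-dec_; decidable-stable)
open import Relation.Unary using (Decidable)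
open import Relation.Binary.PropositionalEquality
  using (_≡_; _≢_; refl; sym; trans; cong; cong₂; subst; module ≡-Reasoning)

∑-mono : ∀ {n} {f g : Fin n → ℕ} → (∀ i → f i ≤ g i) → sum f ≤ sum g
∑-mono {zero}  f≤g = z≤n
∑-mono {suc n} f≤g = +-mono-≤ (f≤g zero) (∑-mono (f≤g ∘ suc))

∑-const : ∀ n c → ∑[ i < n ] c ≡ n * c
∑-const zero    c = refl
∑-const (suc n) c = cong (c +_) (∑-const n c)

term≤∑ : ∀ {n} (f : Fin n → ℕ) i → f i ≤ sum f
term≤∑ f zero    = m≤m+n _ _
term≤∑ f (suc i) = ≤-trans (term≤∑ (f ∘ suc) i) (m≤n+m _ (f zero))

∑-bump : ∀ {n} {f g : Fin n → ℕ} {c} i →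
         (∀ j → f j ≤ g j) → f i + c ≤ g i → sum f + c ≤ sum g
∑-bump {f = f} {c = c} zero f≤g bump = begin
  f zero + sum (f ∘ suc) + c  ≡⟨ xy∙z≈xz∙y (f zero) _ c ⟩
  f zero + c + sum (f ∘ suc)  ≤⟨ +-mono-≤ bump (∑-mono (f≤g ∘ suc)) ⟩
  _                           ∎
  where open ≤-Reasoning
∑-bump {f = f} {c = c} (suc i) f≤g bump = begin
  f zero + sum (f ∘ suc) + c    ≡⟨ +-assoc (f zero) _ c ⟩
  f zero + (sum (f ∘ suc) + c)  ≤⟨ +-mono-≤ (f≤g zero) (∑-bump i (f≤g ∘ suc) bump) ⟩
  _                             ∎
  where open ≤-Reasoning

∑-bump₂ : ∀ {n} {f g : Fin n → ℕ} {c e} {i j} → i ≢ j →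
          (∀ l → f l ≤ g l) → f i + c ≤ g i → f j + e ≤ g j → sum f + c + e ≤ sum g
∑-bump₂ {i = zero} {zero} i≢j = contradiction refl i≢j
∑-bump₂ {f = f} {c = c} {e} {zero} {suc j} _ f≤g bumpᵢ bumpⱼ = begin
  f zero + F + c + e    ≡⟨ cong (_+ e) (xy∙z≈xz∙y (f zero) F c) ⟩
  f zero + c + F + e    ≡⟨ +-assoc (f zero + c) F e ⟩
  f zero + c + (F + e)  ≤⟨ +-mono-≤ bumpᵢ (∑-bump j (f≤g ∘ suc) bumpⱼ) ⟩
  _                     ∎
  where open ≤-Reasoning; F = sum (f ∘ suc)
∑-bump₂ {f = f} {c = c} {e} {suc i} {zero} _ f≤g bumpᵢ bumpⱼ = begin
  f zero + F + c + e    ≡⟨ cong (_+ e) (+-assoc (f zero) F c) ⟩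
  f zero + (F + c) + e  ≡⟨ xy∙z≈xz∙y (f zero) (F + c) e ⟩
  f zero + e + (F + c)  ≤⟨ +-mono-≤ bumpⱼ (∑-bump i (f≤g ∘ suc) bumpᵢ) ⟩
  _                     ∎
  where open ≤-Reasoning; F = sum (f ∘ suc)
∑-bump₂ {f = f} {c = c} {e} {suc i} {suc j} i≢j f≤g bumpᵢ bumpⱼ = begin
  f zero + F + c + e    ≡⟨ cong (_+ e) (+-assoc (f zero) F c) ⟩
  f zero + (F + c) + e  ≡⟨ +-assoc (f zero) (F + c) e ⟩
  f zero + (F + c + e)  ≤⟨ +-mono-≤ (f≤g zero) (∑-bump₂ (i≢j ∘ cong suc) (f≤g ∘ suc) bumpᵢ bumpⱼ) ⟩
  _                     ∎
  where open ≤-Reasoning; F = sum (f ∘ suc)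

indicator : {P : Set} → Dec P → ℕ
indicator P? = if does P? then 1 else 0

indicator≤1 : {P : Set} (P? : Dec P) → indicator P? ≤ 1
indicator≤1 (yes _) = ≤-refl
indicator≤1 (no _)  = z≤n

indicator-yes : {P : Set} → P → (P? : Dec P) → indicator P? ≡ 1
indicator-yes p (yes _) = refl
indicator-yes p (no ¬p) = contradiction p ¬p

indicator-no : {P : Set} → ¬ P → (P? : Dec P) → indicator P? ≡ 0
indicator-no ¬p (yes p) = contradiction p ¬p
indicator-no ¬p (no _)  = refl

indicator-mono : {P Q : Set} → (P → Q) → (P? : Dec P) (Q? : Dec Q) → indicator P? ≤ indicator Q?
indicator-mono P⇒Q (no _)  _       = z≤n
indicator-mono P⇒Q (yes _) (yes _) = ≤-refl
indicator-mono P⇒Q (yes p) (no ¬q) = contradiction (P⇒Q p) ¬q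

indicator-⊎ : {P Q : Set} (P? : Dec P) (Q? : Dec Q) → indicator (P? ⊎-dec Q?) ≤ indicator P? + indicator Q?
indicator-⊎ (yes _) _       = s≤s z≤n
indicator-⊎ (no _)  (yes _) = ≤-refl
indicator-⊎ (no _)  (no _)  = z≤n

count : ∀ {n} {P : Fin n → Set} → Decidable P → ℕ
count {n} P? = ∑[ i < n ] indicator (P? i)

count-complement : ∀ {n} {P : Fin n → Set} (P? : Decidable P) → count P? + count (¬? ∘ P?) ≡ n
count-complement {n} P? = begin
  count P? + count (¬? ∘ P?)                              ≡⟨ ∑-distrib-+ (indicator ∘ P?) (indicator ∘ ¬? ∘ P?) ⟨
  ∑[ i < n ] (indicator (P? i) + indicator (¬? (P? i)))  ≡⟨ sum-cong-≗ (λ i → one (P? i)) ⟩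
  ∑[ i < n ] 1                                            ≡⟨ ∑-const n 1 ⟩
  n * 1                                                   ≡⟨ *-identityʳ n ⟩
  n                                                       ∎
  where
  open ≡-Reasoning
  one : {A : Set} (A? : Dec A) → indicator A? + indicator (¬? A?) ≡ 1
  one (yes _) = refl
  one (no _)  = refl

count-mono : ∀ {n} {P Q : Fin n → Set} (P? : Decidable P) (Q? : Decidable Q) →
             (∀ i → P i → Q i) → count P? ≤ count Q?
count-mono P? Q? P⇒Q = ∑-mono (λ i → indicator-mono (P⇒Q i) (P? i) (Q? i))

count-pos : ∀ {n} {P : Fin n → Set} (P? : Decidable P) {i} → P i → 1 ≤ count P?
count-pos P? {i} p = ≤-trans (≤-reflexive (sym (indicator-yes p (P? i)))) (term≤∑ _ i)

count-witness : ∀ {n} {P : Fin n → Set} (P? : Decidable P) → 1 ≤ count P? → ∃ P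
count-witness {zero}  P? ()
count-witness {suc n} P? 1≤count with P? zero
... | yes p = zero , p
... | no _  = Product.map suc id (count-witness (P? ∘ suc) 1≤count)

count-≤1 : ∀ {n} {P : Fin n → Set} (P? : Decidable P) → (∀ {i j} → P i → P j → i ≡ j) → count P? ≤ 1
count-≤1 {zero}  P? unique = z≤n
count-≤1 {suc n} P? unique with P? zero
... | yes p = s≤s (≮⇒≥ λ 1≤rest → let i , pᵢ = count-witness (P? ∘ suc) 1≤rest in
                                  contradiction (unique p pᵢ) λ ())
... | no _  = count-≤1 (P? ∘ suc) (λ p q → Finₚ.suc-injective (unique p q))

indicator-∃≤count : ∀ {n} {P : Fin n → Set} (P? : Decidable P) → indicator (any? P?) ≤ count P?
indicator-∃≤count P? with any? P?
... | yes (i , p) = count-pos P? p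
... | no _        = z≤n

Word : ℕ → ℕ → Set
Word d n = Vec (Fin d) n

infix 4 _≟ʷ_
_≟ʷ_ : ∀ {d n} (u v : Word d n) → Dec (u ≡ v)
_≟ʷ_ = Vec.≡-dec _≟ᶠ_

infix 4 _∈?_
_∈?_ : ∀ {d n} (w : Word d n) (xs : List (Word d n)) → Dec (w ∈ xs)
w ∈? xs = Any.any? (w ≟ʷ_) xs

∑ʷ : ∀ {d} n → (Word d n → ℕ) → ℕ
∑ʷ     zero    f = f []
∑ʷ {d} (suc n) f = ∑[ a < d ] ∑ʷ n (λ w → f (a ∷ w))

∑ʷ-mono : ∀ {d} n {f g : Word d n → ℕ} → (∀ w → f w ≤ g w) → ∑ʷ n f ≤ ∑ʷ n g
∑ʷ-mono zero    f≤g = f≤g []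
∑ʷ-mono (suc n) f≤g = ∑-mono (λ a → ∑ʷ-mono n (λ w → f≤g (a ∷ w)))

∑ʷ-distrib-+ : ∀ {d} n (f g : Word d n → ℕ) → ∑ʷ n (λ w → f w + g w) ≡ ∑ʷ n f + ∑ʷ n g
∑ʷ-distrib-+     zero    f g = refl
∑ʷ-distrib-+ {d} (suc n) f g = begin
  ∑[ a < d ] ∑ʷ n (λ w → f (a ∷ w) + g (a ∷ w))  ≡⟨ sum-cong-≗ (λ a → ∑ʷ-distrib-+ n (f′ a) (g′ a)) ⟩
  ∑[ a < d ] (∑ʷ n (f′ a) + ∑ʷ n (g′ a))          ≡⟨ ∑-distrib-+ (λ a → ∑ʷ n (f′ a)) (λ a → ∑ʷ n (g′ a)) ⟩
  ∑ʷ (suc n) f + ∑ʷ (suc n) g                     ∎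
  where
  open ≡-Reasoning
  f′ g′ : Fin d → Word d n → ℕ
  f′ a = f ∘ (a ∷_)
  g′ a = g ∘ (a ∷_)

∑ʷ-zero : ∀ {d} n → ∑ʷ {d} n (λ _ → 0) ≡ 0
∑ʷ-zero     zero    = refl
∑ʷ-zero {d} (suc n) = trans (sum-cong-≗ {d} (λ _ → ∑ʷ-zero {d} n)) (sum-replicate-zero d)

∑ʷ-≡≤1 : ∀ {d n} (x : Word d n) → ∑ʷ n (λ w → indicator (w ≟ʷ x)) ≤ 1
∑ʷ-≡≤1 {d} [] = indicator≤1 (_≟ʷ_ {d} [] [])
∑ʷ-≡≤1 {n = suc n} (x ∷ xs) = ≤-trans (∑-mono slice) (count-≤1 (_≟ᶠ x) (λ p q → trans p (sym q)))
  where
  slice : ∀ a → ∑ʷ n (λ w → indicator (a ∷ w ≟ʷ x ∷ xs)) ≤ indicator (a ≟ᶠ x)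
  slice a = bound (a ≟ᶠ x)
    where
    bound : (a≟x : Dec (a ≡ x)) → ∑ʷ n (λ w → indicator (a ∷ w ≟ʷ x ∷ xs)) ≤ indicator a≟x
    bound (yes refl) = ≤-trans (∑ʷ-mono n (λ w → indicator-mono ∷-injectiveʳ (a ∷ w ≟ʷ a ∷ xs) (w ≟ʷ xs)))
                               (∑ʷ-≡≤1 xs)
    bound (no a≢x)   = ≤-trans (∑ʷ-mono n λ w →
                                  ≤-reflexive (indicator-no (a≢x ∘ ∷-injectiveˡ) (a ∷ w ≟ʷ x ∷ xs)))
                               (≤-reflexive (∑ʷ-zero n))

∑ʷ-∈≤length : ∀ {d n} (xs : List (Word d n)) → ∑ʷ n (λ w → indicator (w ∈? xs)) ≤ length xs
∑ʷ-∈≤length {n = n} []       = ≤-reflexive (∑ʷ-zero n)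
∑ʷ-∈≤length {n = n} (x ∷ xs) = begin
  ∑ʷ n (λ w → indicator (w ∈? x ∷ xs))                       ≤⟨ ∑ʷ-mono n (λ w → ∈∷ w) ⟩
  ∑ʷ n (λ w → indicator (w ≟ʷ x) + indicator (w ∈? xs))     ≡⟨ ∑ʷ-distrib-+ n _ _ ⟩
  ∑ʷ n (λ w → indicator (w ≟ʷ x)) + ∑ʷ n (λ w → indicator (w ∈? xs))
                                                             ≤⟨ +-mono-≤ (∑ʷ-≡≤1 x) (∑ʷ-∈≤length xs) ⟩
  suc (length xs)                                            ∎
  where
  open ≤-Reasoning
  ∈∷ : ∀ w → indicator (w ∈? x ∷ xs) ≤ indicator (w ≟ʷ x) + indicator (w ∈? xs)
  ∈∷ w = ≤-trans (indicator-mono toSum (w ∈? x ∷ xs) (w ≟ʷ x ⊎-dec w ∈? xs))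
                 (indicator-⊎ (w ≟ʷ x) (w ∈? xs))

m+[n∸1]≤m⊔n : ∀ {m} n → m ≤ 1 → m + (n ∸ 1) ≤ m ⊔ n
m+[n∸1]≤m⊔n n       z≤n       = m∸n≤m n 1
m+[n∸1]≤m⊔n zero    (s≤s z≤n) = ≤-refl
m+[n∸1]≤m⊔n (suc n) (s≤s z≤n) = ≤-refl

m+n≤1+m+o*[n∸1] : ∀ m {n o} → n ≢ 0 → o ≢ 0 → m + n ≤ suc (m + o * (n ∸ 1))
m+n≤1+m+o*[n∸1] m {zero}          n≢0 _   = contradiction refl n≢0
m+n≤1+m+o*[n∸1] m {suc n} {zero}  _   o≢0 = contradiction refl o≢0
m+n≤1+m+o*[n∸1] m {suc n} {suc o} _   _   = begin
  m + suc n              ≡⟨ +-suc m n ⟩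
  suc (m + n)            ≤⟨ s≤s (+-monoʳ-≤ m (m≤m+n n (o * n))) ⟩
  suc (m + (n + o * n))  ∎
  where open ≤-Reasoning

*-scale-≤ : ∀ {d k a s} → k ≤ a → a * d ≤ s → d * k ≤ s
*-scale-≤ {d} {a = a} k≤a a*d≤s = ≤-trans (*-monoʳ-≤ d k≤a) (≤-trans (≤-reflexive (*-comm d a)) a*d≤s)

m+m≤1+n+n⇒m≤n : ∀ {m n} → m + m ≤ suc (n + n) → m ≤ n
m+m≤1+n+n⇒m≤n {m} {n} le = begin
  m                    ≡⟨ n≡⌊n+n/2⌋ m ⟩
  ⌊ m + m /2⌋          ≤⟨ ⌊n/2⌋-mono le ⟩
  ⌊ suc (n + n) /2⌋    ≡⟨ n≡⌈n+n/2⌉ n ⟨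
  n                    ∎
  where open ≤-Reasoning

⌈n/2⌉+⌈n/2⌉≡n∨1+n : ∀ n → ⌈ n /2⌉ + ⌈ n /2⌉ ≡ n ⊎ ⌈ n /2⌉ + ⌈ n /2⌉ ≡ suc n
⌈n/2⌉+⌈n/2⌉≡n∨1+n zero          = inj₁ refl
⌈n/2⌉+⌈n/2⌉≡n∨1+n (suc zero)    = inj₂ refl
⌈n/2⌉+⌈n/2⌉≡n∨1+n (suc (suc n)) = Sum.map step step (⌈n/2⌉+⌈n/2⌉≡n∨1+n n)
  where
  step : ∀ {m} → ⌈ n /2⌉ + ⌈ n /2⌉ ≡ m → suc ⌈ n /2⌉ + suc ⌈ n /2⌉ ≡ suc (suc m)
  step eq = cong suc (trans (+-suc ⌈ n /2⌉ ⌈ n /2⌉) (cong suc eq))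

⌈n/2⌉+⌈n/2⌉≤1+n : ∀ n → ⌈ n /2⌉ + ⌈ n /2⌉ ≤ suc n
⌈n/2⌉+⌈n/2⌉≤1+n n =
  [ (λ eq → ≤-trans (≤-reflexive eq) (n≤1+n n)) , ≤-reflexive ]′ (⌈n/2⌉+⌈n/2⌉≡n∨1+n n)

mixed-pair : ∀ {d g h} → 2 ≤ d → d ≤ suc g → d ≤ suc h → d + (d ∸ 2) ≤ g + h
mixed-pair {suc zero}    (s≤s ()) _ _
mixed-pair {suc (suc d)} _ (s≤s 1+d≤g) (s≤s 1+d≤h) =
  ≤-trans (≤-reflexive (cong suc (sym (+-suc d d)))) (+-mono-≤ 1+d≤g 1+d≤h)

two-mixed-bound : ∀ d s → 2 ≤ d → d * d + (d ∸ 2) + (d ∸ 2) ≤ s + s → d * ⌈ d /2⌉ ≤ s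
two-mixed-bound d s d≥2 le = m+m≤1+n+n⇒m≤n (begin
  d * k + d * k  ≡⟨ *-distribˡ-+ d k k ⟨
  d * (k + k)    ≤⟨ [ even , odd ]′ (⌈n/2⌉+⌈n/2⌉≡n∨1+n d) ⟩
  suc (s + s)    ∎)
  where
  open ≤-Reasoning
  k = ⌈ d /2⌉
  even : k + k ≡ d → d * (k + k) ≤ suc (s + s)
  even eq = begin
    d * (k + k)                      ≡⟨ cong (d *_) eq ⟩
    d * d                            ≤⟨ m≤m+n (d * d) _ ⟩
    d * d + ((d ∸ 2) + (d ∸ 2))      ≡⟨ +-assoc (d * d) _ _ ⟨
    d * d + (d ∸ 2) + (d ∸ 2)        ≤⟨ le ⟩
    s + s                            ≤⟨ n≤1+n _ ⟩
    suc (s + s)                      ∎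
  -- an odd d ≥ 2 is at least 3, so d ≤ 2(d ∸ 2) + 1
  odd : k + k ≡ suc d → d * (k + k) ≤ suc (s + s)
  odd eq = begin
    d * (k + k)                          ≡⟨ cong (d *_) eq ⟩
    d * suc d                            ≡⟨ trans (*-suc d d) (+-comm d (d * d)) ⟩
    d * d + d                            ≤⟨ +-monoʳ-≤ (d * d) (three d d≥2 eq) ⟩
    d * d + suc ((d ∸ 2) + (d ∸ 2))      ≡⟨ +-suc (d * d) _ ⟩
    suc (d * d + ((d ∸ 2) + (d ∸ 2)))    ≡⟨ cong suc (+-assoc (d * d) _ _) ⟨
    suc (d * d + (d ∸ 2) + (d ∸ 2))      ≤⟨ s≤s le ⟩
    suc (s + s)                          ∎
    where
    three : ∀ n → 2 ≤ n → ⌈ n /2⌉ + ⌈ n /2⌉ ≡ suc n → n ≤ suc ((n ∸ 2) + (n ∸ 2))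
    three (suc zero)          (s≤s ()) _
    three (suc (suc zero))    _ ()
    three (suc (suc (suc n))) _ _ = s≤s (s≤s (m≤n+m (suc n) n))

at-least-one : ∀ {k d a b c} → k + k ≤ suc d → d ≤ a + b + c → a < k → b < k → 1 ≤ c
at-least-one {k} {d} {a} {b} {c} k+k≤1+d d≤ a<k b<k = +-cancelˡ-≤ (a + b) 1 c (begin
  a + b + 1            ≡⟨ +-comm (a + b) 1 ⟩
  suc (a + b)          ≤⟨ s≤s⁻¹ (begin
    suc (suc (a + b))    ≡⟨ cong suc (+-suc a b) ⟨
    suc a + suc b        ≤⟨ +-mono-≤ a<k b<k ⟩
    k + k                ≤⟨ k+k≤1+d ⟩
    suc d                ≤⟨ s≤s d≤ ⟩
    suc (a + b + c)      ∎) ⟩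
  a + b + c            ∎)
  where open ≤-Reasoning

balance : ∀ {k d a b c e} → k + k ≤ suc d → d + e ≤ a + b + c → c ≤ 1 → b < k → k + e ≤ suc a
balance {k} {d} {a} {b} {c} {e} k+k≤1+d d+e≤ c≤1 b<k = +-cancelˡ-≤ k (k + e) (suc a) (begin
  k + (k + e)          ≡⟨ +-assoc k k e ⟨
  k + k + e            ≤⟨ +-monoˡ-≤ e k+k≤1+d ⟩
  suc (d + e)          ≤⟨ s≤s d+e≤ ⟩
  suc (a + b + c)      ≤⟨ s≤s (+-monoʳ-≤ (a + b) c≤1) ⟩
  suc (a + b + 1)      ≡⟨ cong suc (trans (+-assoc a b 1) (cong (a +_) (+-comm b 1))) ⟩
  suc (a + suc b)      ≤⟨ s≤s (+-monoʳ-≤ a b<k) ⟩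
  suc a + k            ≡⟨ +-comm (suc a) k ⟩
  k + suc a            ∎)
  where open ≤-Reasoning

-- Ternary relations on the alphabet

-- Domination in cDB(d,1,3), stated for the set of words pmr with R p m r.
Covered : ∀ {d} → (Fin d → Fin d → Fin d → Set) → Set
Covered R = ∀ a b c → R a b c ⊎ (∃ λ p → R p a b) ⊎ (∃ λ r → R b c r)

module _ {d : ℕ} {R : Fin d → Fin d → Fin d → Set} (R? : ∀ p m r → Dec (R p m r)) where

  withMiddle : Fin d → ℕ
  withMiddle m = ∑[ r < d ] count (λ p → R? p m r)

  size : ℕ
  size = ∑[ m < d ] withMiddle m

module Counting {d : ℕ} {R : Fin d → Fin d → Fin d → Set}
                (R? : ∀ p m r → Dec (R p m r)) (covered : Covered R) where

  Suffix Prefix : Fin d → Fin d → Set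
  Suffix a b = ∃ λ p → R p a b
  Prefix b c = ∃ λ r → R b c r

  suffix? : ∀ a b → Dec (Suffix a b)
  suffix? a b = any? (λ p → R? p a b)

  prefix? : ∀ b c → Dec (Prefix b c)
  prefix? b c = any? (λ r → R? b c r)

  forced : ∀ {a b c} → ¬ Suffix a b → ¬ Prefix b c → R a b c
  forced {a} {b} {c} ¬s ¬p =
    [ id , [ (λ s → contradiction s ¬s) , (λ p → contradiction p ¬p) ] ] (covered a b c)

  -- nonSuffixes b and nonPrefixes b are x_b and y_b.
  suffixes nonSuffixes nonPrefixes suffixesFrom : Fin d → ℕ
  suffixes     b = count (λ a → suffix? a b)
  nonSuffixes  b = count (λ a → ¬? (suffix? a b))
  nonPrefixes  b = count (λ c → ¬? (prefix? b c))
  suffixesFrom m = count (suffix? m)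

  excess weight : Fin d → ℕ
  excess b = nonPrefixes b * (nonSuffixes b ∸ 1)
  weight b = suffixes b + excess b

  -- When mr is not a prefix, every word pmr with pm not a suffix is forced into R.
  fibre-bound : ∀ m r → indicator (suffix? m r) + indicator (¬? (prefix? m r)) * (nonSuffixes m ∸ 1)
                        ≤ count (λ p → R? p m r)
  fibre-bound m r with prefix? m r
  ... | yes _ = ≤-trans (≤-reflexive (+-identityʳ _)) (indicator-∃≤count (λ p → R? p m r))
  ... | no ¬p = begin
    indicator (suffix? m r) + 1 * (nonSuffixes m ∸ 1)  ≡⟨ cong (indicator (suffix? m r) +_) (*-identityˡ _) ⟩
    indicator (suffix? m r) + (nonSuffixes m ∸ 1)      ≤⟨ m+[n∸1]≤m⊔n _ (indicator≤1 (suffix? m r)) ⟩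
    indicator (suffix? m r) ⊔ nonSuffixes m            ≤⟨ ⊔-lub (indicator-∃≤count (λ p → R? p m r)) forced-column ⟩
    count (λ p → R? p m r)                             ∎
    where
    open ≤-Reasoning
    forced-column : nonSuffixes m ≤ count (λ p → R? p m r)
    forced-column = count-mono (λ a → ¬? (suffix? a m)) (λ p → R? p m r) (λ p ¬s → forced ¬s ¬p)

  withMiddle-bound : ∀ m → suffixesFrom m + excess m ≤ withMiddle R? m
  withMiddle-bound m = begin
    suffixesFrom m + excess m
      ≡⟨ cong (suffixesFrom m +_) (*-distribʳ-sum (nonSuffixes m ∸ 1) notPrefix) ⟩
    suffixesFrom m + ∑[ r < d ] (notPrefix r * (nonSuffixes m ∸ 1))
      ≡⟨ ∑-distrib-+ (λ r → indicator (suffix? m r)) (λ r → notPrefix r * (nonSuffixes m ∸ 1)) ⟨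
    ∑[ r < d ] (indicator (suffix? m r) + notPrefix r * (nonSuffixes m ∸ 1))
      ≤⟨ ∑-mono (fibre-bound m) ⟩
    withMiddle R? m
      ∎
    where
    open ≤-Reasoning
    notPrefix : Fin d → ℕ
    notPrefix r = indicator (¬? (prefix? m r))

  suffixesFrom≤withMiddle : ∀ m → suffixesFrom m ≤ withMiddle R? m
  suffixesFrom≤withMiddle m = ≤-trans (m≤m+n _ _) (withMiddle-bound m)

  ∑weight≤size : ∑[ b < d ] weight b ≤ size R?
  ∑weight≤size = begin
    ∑[ b < d ] weight b
      ≡⟨ ∑-distrib-+ suffixes excess ⟩
    ∑[ b < d ] suffixes b + ∑[ b < d ] excess b
      ≡⟨ cong (_+ ∑[ b < d ] excess b) (∑-comm (λ b a → indicator (suffix? a b))) ⟩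
    ∑[ m < d ] suffixesFrom m + ∑[ b < d ] excess b
      ≡⟨ ∑-distrib-+ suffixesFrom excess ⟨
    ∑[ m < d ] (suffixesFrom m + excess m)
      ≤⟨ ∑-mono withMiddle-bound ⟩
    size R?
      ∎
    where open ≤-Reasoning

  full⇒suffix : ∀ {a b} → nonSuffixes b ≡ 0 → Suffix a b
  full⇒suffix {a} {b} full = decidable-stable (suffix? a b) λ ¬s →
    contradiction (subst (1 ≤_) full (count-pos (λ a → ¬? (suffix? a b)) ¬s)) λ ()

  full⇒d≤weight : ∀ {b} → nonSuffixes b ≡ 0 → d ≤ weight b
  full⇒d≤weight {b} full = begin
    d                           ≡⟨ count-complement (λ a → suffix? a b) ⟨
    suffixes b + nonSuffixes b  ≡⟨ cong (suffixes b +_) full ⟩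
    suffixes b + 0              ≤⟨ +-monoʳ-≤ (suffixes b) z≤n ⟩
    weight b                    ∎
    where open ≤-Reasoning

  Mixed : Fin d → Set
  Mixed b = nonSuffixes b ≢ 0 × nonPrefixes b ≢ 0

  mixed⇒d≤1+weight : ∀ {b} → Mixed b → d ≤ suc (weight b)
  mixed⇒d≤1+weight {b} (x≢0 , y≢0) = begin
    d                           ≡⟨ count-complement (λ a → suffix? a b) ⟨
    suffixes b + nonSuffixes b  ≤⟨ m+n≤1+m+o*[n∸1] (suffixes b) x≢0 y≢0 ⟩
    suc (weight b)              ∎
    where open ≤-Reasoning

  fullLetters : ℕ
  fullLetters = count (λ b → nonSuffixes b ≟ 0)

  full-weight : ∀ b → indicator (nonSuffixes b ≟ 0) * d ≤ weight b
  full-weight b = bound (nonSuffixes b ≟ 0)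
    where
    bound : (full? : Dec (nonSuffixes b ≡ 0)) → indicator full? * d ≤ weight b
    bound (yes full) = ≤-trans (≤-reflexive (+-identityʳ d)) (full⇒d≤weight full)
    bound (no _)     = z≤n

  fullLetters*d≤size : fullLetters * d ≤ size R?
  fullLetters*d≤size = begin
    fullLetters * d                                 ≡⟨ *-distribʳ-sum d (λ b → indicator (nonSuffixes b ≟ 0)) ⟩
    ∑[ b < d ] (indicator (nonSuffixes b ≟ 0) * d)  ≤⟨ ∑-mono full-weight ⟩
    ∑[ b < d ] weight b                             ≤⟨ ∑weight≤size ⟩
    size R?                                         ∎
    where open ≤-Reasoning

  1+fullLetters≤suffixesFrom : ∀ {q m} → nonSuffixes q ≢ 0 → Suffix m q → suc fullLetters ≤ suffixesFrom m
  1+fullLetters≤suffixesFrom {q} {m} x≢0 s = begin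
    suc fullLetters  ≡⟨ +-comm 1 fullLetters ⟩
    fullLetters + 1  ≤⟨ ∑-bump q (λ b → indicator-mono full⇒suffix (nonSuffixes b ≟ 0) (suffix? m b)) at-q ⟩
    suffixesFrom m   ∎
    where
    open ≤-Reasoning
    at-q : indicator (nonSuffixes q ≟ 0) + 1 ≤ indicator (suffix? m q)
    at-q = ≤-reflexive (trans (cong (_+ 1) (indicator-no x≢0 (nonSuffixes q ≟ 0)))
                              (sym (indicator-yes s (suffix? m q))))

  -- The word zqz is forced into R; the mixed letter q then contributes d ∸ 1 to the sum of
  -- weights and z at least 1, since qz is a suffix.
  1+fullLetters*d≤size : ∀ {q z} → Mixed q → ¬ Suffix z q → ¬ Prefix q z → nonSuffixes z ≢ 0 →
                         suc fullLetters * d ≤ size R?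
  1+fullLetters*d≤size {q} {z} mixed ¬s ¬p xz≢0 = begin
    suc fullLetters * d                                          ≡⟨ +-comm d (fullLetters * d) ⟩
    fullLetters * d + d                                          ≡⟨ cong (fullLetters * d +_) (m∸n+n≡m 1≤d) ⟨
    fullLetters * d + (d ∸ 1 + 1)                                ≡⟨ +-assoc (fullLetters * d) (d ∸ 1) 1 ⟨
    fullLetters * d + (d ∸ 1) + 1
      ≡⟨ cong (λ t → t + (d ∸ 1) + 1) (*-distribʳ-sum d (λ b → indicator (nonSuffixes b ≟ 0))) ⟩
    ∑[ b < d ] (indicator (nonSuffixes b ≟ 0) * d) + (d ∸ 1) + 1  ≤⟨ ∑-bump₂ q≢z full-weight at-q at-z ⟩
    ∑[ b < d ] weight b                                          ≤⟨ ∑weight≤size ⟩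
    size R?                                                      ∎
    where
    open ≤-Reasoning
    cell : R z q z
    cell = forced ¬s ¬p
    q≢z : q ≢ z
    q≢z refl = ¬s (q , cell)
    1≤d : 1 ≤ d
    1≤d = ≤-trans (s≤s z≤n) (Finₚ.toℕ<n q)
    at-q : indicator (nonSuffixes q ≟ 0) * d + (d ∸ 1) ≤ weight q
    at-q rewrite indicator-no (proj₁ mixed) (nonSuffixes q ≟ 0) = ∸-monoˡ-≤ 1 (mixed⇒d≤1+weight mixed)
    at-z : indicator (nonSuffixes z ≟ 0) * d + 1 ≤ weight z
    at-z rewrite indicator-no xz≢0 (nonSuffixes z ≟ 0) =
      ≤-trans (count-pos (λ a → suffix? a z) (z , cell)) (m≤m+n _ _)

module LowerBound {d : ℕ} {R : Fin d → Fin d → Fin d → Set}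
                  (R? : ∀ p m r → Dec (R p m r)) (covered : Covered R) where

  reversed? : ∀ p m r → Dec (R r m p)
  reversed? p m r = R? r m p

  covered-reversed : Covered (λ p m r → R r m p)
  covered-reversed a b c = Sum.map₂ Sum.swap (covered c b a)

  -- B is F for the reversed words, so B.nonSuffixes = F.nonPrefixes and B.weight is the mirror bound.
  module F = Counting R? covered
  module B = Counting reversed? covered-reversed

  k : ℕ
  k = ⌈ d /2⌉

  withMiddle-reversed : ∀ m → withMiddle reversed? m ≡ withMiddle R? m
  withMiddle-reversed m = ∑-comm (λ r p → indicator (R? r m p))

  size-reversed : size reversed? ≡ size R?
  size-reversed = sum-cong-≗ withMiddle-reversed

  mixed⇒weights≥2d∸2 : 2 ≤ d → ∀ {b} → F.Mixed b → d + (d ∸ 2) ≤ F.weight b + B.weight b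
  mixed⇒weights≥2d∸2 d≥2 (x≢0 , y≢0) =
    mixed-pair d≥2 (F.mixed⇒d≤1+weight (x≢0 , y≢0)) (B.mixed⇒d≤1+weight (y≢0 , x≢0))

  weights≥d : 2 ≤ d → ∀ b → d ≤ F.weight b + B.weight b
  weights≥d d≥2 b with F.nonSuffixes b ≟ 0 | F.nonPrefixes b ≟ 0
  ... | yes full | _        = ≤-trans (F.full⇒d≤weight full) (m≤m+n (F.weight b) (B.weight b))
  ... | no _     | yes full = ≤-trans (B.full⇒d≤weight full) (m≤n+m (B.weight b) (F.weight b))
  ... | no x≢0   | no y≢0   = ≤-trans (m≤m+n d (d ∸ 2)) (mixed⇒weights≥2d∸2 d≥2 (x≢0 , y≢0))

  two-mixed : 2 ≤ d → ∀ {q q′} → q ≢ q′ → F.Mixed q → F.Mixed q′ → d * k ≤ size R?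
  two-mixed d≥2 q≢q′ mixed mixed′ = two-mixed-bound d (size R?) d≥2 (begin
    d * d + (d ∸ 2) + (d ∸ 2)
      ≡⟨ cong (λ t → t + (d ∸ 2) + (d ∸ 2)) (∑-const d d) ⟨
    ∑[ b < d ] d + (d ∸ 2) + (d ∸ 2)
      ≤⟨ ∑-bump₂ q≢q′ (weights≥d d≥2) (mixed⇒weights≥2d∸2 d≥2 mixed) (mixed⇒weights≥2d∸2 d≥2 mixed′) ⟩
    ∑[ b < d ] (F.weight b + B.weight b)
      ≡⟨ ∑-distrib-+ F.weight B.weight ⟩
    ∑[ b < d ] F.weight b + ∑[ b < d ] B.weight b
      ≤⟨ +-mono-≤ F.∑weight≤size (≤-trans B.∑weight≤size (≤-reflexive size-reversed)) ⟩
    size R? + size R?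
      ∎)
    where open ≤-Reasoning

  both? : Decidable (λ b → F.nonSuffixes b ≡ 0 × F.nonPrefixes b ≡ 0)
  both? b = F.nonSuffixes b ≟ 0 ×-dec F.nonPrefixes b ≟ 0

  mixed? : Decidable F.Mixed
  mixed? b = ¬? (F.nonSuffixes b ≟ 0) ×-dec ¬? (F.nonPrefixes b ≟ 0)

  letter-count : d + count both? ≤ F.fullLetters + B.fullLetters + count mixed?
  letter-count = begin
    d + count both?
      ≡⟨ cong (_+ count both?) (trans (∑-const d 1) (*-identityʳ d)) ⟨
    ∑[ b < d ] 1 + count both?
      ≡⟨ ∑-distrib-+ (λ _ → 1) (indicator ∘ both?) ⟨
    ∑[ b < d ] (1 + indicator (both? b))
      ≤⟨ ∑-mono (λ b → letter (F.nonSuffixes b ≟ 0) (F.nonPrefixes b ≟ 0)) ⟩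
    ∑[ b < d ] (full b + full′ b + indicator (mixed? b))
      ≡⟨ ∑-distrib-+ (λ b → full b + full′ b) (indicator ∘ mixed?) ⟩
    ∑[ b < d ] (full b + full′ b) + count mixed?
      ≡⟨ cong (_+ count mixed?) (∑-distrib-+ full full′) ⟩
    F.fullLetters + B.fullLetters + count mixed?
      ∎
    where
    open ≤-Reasoning
    full full′ : Fin d → ℕ
    full  b = indicator (F.nonSuffixes b ≟ 0)
    full′ b = indicator (F.nonPrefixes b ≟ 0)
    letter : {X Y : Set} (X? : Dec X) (Y? : Dec Y) →
             1 + indicator (X? ×-dec Y?) ≤ indicator X? + indicator Y? + indicator (¬? X? ×-dec ¬? Y?)
    letter (yes _) (yes _) = ≤-refl
    letter (yes _) (no _)  = ≤-refl
    letter (no _)  (yes _) = ≤-refl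
    letter (no _)  (no _)  = ≤-refl

  some-mixed : ¬ k ≤ F.fullLetters → ¬ k ≤ B.fullLetters → ∃ F.Mixed
  some-mixed k≰a k≰b = count-witness mixed?
    (at-least-one (⌈n/2⌉+⌈n/2⌉≤1+n d) (≤-trans (m≤m+n d _) letter-count) (≰⇒> k≰a) (≰⇒> k≰b))

  module OneMixed {q} (mixed : F.Mixed q) (only : ∀ {b} → F.Mixed b → b ≡ q)
                  (a<k : F.fullLetters < k) (b<k : B.fullLetters < k) where

    mixed≤1 : count mixed? ≤ 1
    mixed≤1 = count-≤1 mixed? (λ mb mb′ → trans (only mb) (sym (only mb′)))

    balanced : k + count both? ≤ suc F.fullLetters
    balanced = balance (⌈n/2⌉+⌈n/2⌉≤1+n d) letter-count mixed≤1 b<k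

    balanced′ : k + count both? ≤ suc B.fullLetters
    balanced′ = balance (⌈n/2⌉+⌈n/2⌉≤1+n d) letter-count′ mixed≤1 a<k
      where
      letter-count′ : d + count both? ≤ B.fullLetters + F.fullLetters + count mixed?
      letter-count′ = subst (d + count both? ≤_)
                            (cong (_+ count mixed?) (+-comm F.fullLetters B.fullLetters)) letter-count

    k≤1+a : k ≤ suc F.fullLetters
    k≤1+a = ≤-trans (m≤m+n k _) balanced

    k≤1+b : k ≤ suc B.fullLetters
    k≤1+b = ≤-trans (m≤m+n k _) balanced′

    no-both : ∀ {z} → F.nonSuffixes z ≡ 0 → F.nonPrefixes z ≡ 0 → ⊥
    no-both x≡0 y≡0 = <⇒≱ a<k (s≤s⁻¹ (begin
      suc k            ≡⟨ +-comm 1 k ⟩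
      k + 1            ≤⟨ +-monoʳ-≤ k (count-pos both? (x≡0 , y≡0)) ⟩
      k + count both?  ≤⟨ balanced ⟩
      suc F.fullLetters ∎))
      where open ≤-Reasoning

    middle-large : (∀ m → ¬ (¬ F.Suffix m q × ¬ F.Prefix q m)) → ∀ m → k ≤ withMiddle R? m
    middle-large none m with F.suffix? m q | F.prefix? q m
    ... | yes s | _     = ≤-trans k≤1+a (≤-trans (F.1+fullLetters≤suffixesFrom (proj₁ mixed) s)
                                                  (F.suffixesFrom≤withMiddle m))
    ... | no _  | yes p = ≤-trans k≤1+b (≤-trans (B.1+fullLetters≤suffixesFrom (proj₂ mixed) p)
                                          (≤-trans (B.suffixesFrom≤withMiddle m)
                                                   (≤-reflexive (withMiddle-reversed m))))
    ... | no ¬s | no ¬p = contradiction (¬s , ¬p) (none m)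

    one-mixed : d * k ≤ size R?
    one-mixed with any? (λ z → ¬? (F.suffix? z q) ×-dec ¬? (F.prefix? q z))
    ... | no none = ≤-trans (≤-reflexive (sym (∑-const d k))) (∑-mono (middle-large λ m c → none (m , c)))
    ... | yes (z , ¬s , ¬p) with F.nonSuffixes z ≟ 0 | F.nonPrefixes z ≟ 0
    ...   | no x≢0  | _       = *-scale-≤ k≤1+a (F.1+fullLetters*d≤size mixed ¬s ¬p x≢0)
    ...   | yes _   | no y≢0  =
      *-scale-≤ k≤1+b (≤-trans (B.1+fullLetters*d≤size (Product.swap mixed) ¬p ¬s y≢0) (≤-reflexive size-reversed))
    ...   | yes x≡0 | yes y≡0 = ⊥-elim (no-both x≡0 y≡0)

  lower-bound : 2 ≤ d → d * k ≤ size R?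
  lower-bound d≥2 with k ≤? F.fullLetters | k ≤? B.fullLetters
  ... | yes k≤a | _       = *-scale-≤ k≤a F.fullLetters*d≤size
  ... | no _    | yes k≤b = *-scale-≤ k≤b (≤-trans B.fullLetters*d≤size (≤-reflexive size-reversed))
  ... | no k≰a  | no k≰b with some-mixed k≰a k≰b
  ...   | q , mixed with any? (λ b → ¬? (b ≟ᶠ q) ×-dec mixed? b)
  ...     | yes (q′ , q′≢q , mixed′) = two-mixed d≥2 q′≢q mixed′ mixed
  ...     | no none = OneMixed.one-mixed mixed
                        (λ {b} mb → decidable-stable (b ≟ᶠ q) (λ b≢q → none (b , b≢q , mb)))
                        (≰⇒> k≰a) (≰⇒> k≰b)

-- Domination in cDB(d,1,3)

every-word-1-constrained : ∀ {d n} (w : Word d n) → Constrained 1 w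
every-word-1-constrained w i j i<j _ = m<n⇒0<n∸m i<j

adjacent⇒dominates : ∀ {d m} {u v : Word d (suc m)} → Arc u v ⊎ Arc v u → Dominates 1 u v
adjacent⇒dominates {u = u} {v} arc with u ≟ʷ v
... | yes u≡v = inj₁ u≡v
... | no u≢v  = inj₂ (every-word-1-constrained u , every-word-1-constrained v , u≢v , arc)

module _ {d : ℕ} (S : List (Word d 3)) where

  inS? : ∀ p m r → Dec (p ∷ m ∷ r ∷ [] ∈ S)
  inS? p m r = p ∷ m ∷ r ∷ [] ∈? S

  dominating⇒covered : IsDominating 1 S → Covered (λ p m r → p ∷ m ∷ r ∷ [] ∈ S)
  dominating⇒covered (_ , dominated) a b c
    with find (dominated (a ∷ b ∷ c ∷ []) (every-word-1-constrained (a ∷ b ∷ c ∷ [])))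
  ... | _                 , u∈S , inj₁ refl                     = inj₁ u∈S
  ... | p ∷ .a ∷ .b ∷ []  , u∈S , inj₂ (_ , _ , _ , inj₁ refl)  = inj₂ (inj₁ (p , u∈S))
  ... | .b ∷ .c ∷ r ∷ []  , u∈S , inj₂ (_ , _ , _ , inj₂ refl)  = inj₂ (inj₂ (r , u∈S))

  size≤length : size inS? ≤ length S
  size≤length = begin
    size inS?
      ≡⟨ sum-cong-≗ (λ m → ∑-comm (λ r p → indicator (inS? p m r))) ⟩
    ∑[ m < d ] ∑[ p < d ] ∑[ r < d ] indicator (inS? p m r)
      ≡⟨ ∑-comm (λ m p → ∑[ r < d ] indicator (inS? p m r)) ⟩
    ∑ʷ 3 (λ w → indicator (w ∈? S))
      ≤⟨ ∑ʷ-∈≤length S ⟩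
    length S
      ∎
    where open ≤-Reasoning

module Pairing {d k : ℕ} (start end : Fin k → Fin d)
               (end-injective : ∀ {i j} → end i ≡ end j → i ≡ j)
               (pairs-cover : ∀ b → ∃ λ i → end i ≡ b ⊎ start i ≡ b) where

  pairWord : Fin d × Fin k → Word d 3
  pairWord (x , i) = start i ∷ x ∷ end i ∷ []

  pairWords : List (Word d 3)
  pairWords = tabulate (pairWord ∘ remQuot k)

  pairWord-injective : ∀ {u v} → pairWord u ≡ pairWord v → u ≡ v
  pairWord-injective eq with ∷-injective eq
  ... | _ , eq′ with ∷-injective eq′
  ... | x≡y , eq″ = cong₂ _,_ x≡y (end-injective (∷-injectiveˡ eq″))

  pairWords-unique : Unique pairWords
  pairWords-unique = tabulate⁺ λ {i} {j} eq → begin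
    i                                    ≡⟨ combine-remQuot {d} k i ⟨
    uncurry combine (remQuot {d} k i)  ≡⟨ cong (uncurry combine) (pairWord-injective eq) ⟩
    uncurry combine (remQuot {d} k j)  ≡⟨ combine-remQuot {d} k j ⟩
    j                             ∎
    where open ≡-Reasoning

  length-pairWords : length pairWords ≡ d * k
  length-pairWords = length-tabulate (pairWord ∘ remQuot k)

  pairWord∈pairWords : ∀ x i → pairWord (x , i) ∈ pairWords
  pairWord∈pairWords x i =
    subst (_∈ pairWords) (cong pairWord (remQuot-combine x i)) (∈-tabulate⁺ (combine x i))

  pairWords-dominating : IsDominating 1 pairWords
  pairWords-dominating = universal every-word-1-constrained pairWords , λ v _ → dominated v
    where
    dominated : ∀ v → Any (λ u → Dominates 1 u v) pairWords
    dominated (a ∷ b ∷ c ∷ []) with pairs-cover b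
    ... | i , inj₁ refl = lose (pairWord∈pairWords a i) (adjacent⇒dominates (inj₁ refl))
    ... | i , inj₂ refl = lose (pairWord∈pairWords c i) (adjacent⇒dominates (inj₂ refl))

-- evens i = 2i and odds i = 2i+1, except that for odd d the last pair is {d-1, d-1}.
evens odds : ∀ {d} → Fin ⌈ d /2⌉ → Fin d
evens {suc zero}    zero    = zero
evens {suc (suc d)} zero    = zero
evens {suc (suc d)} (suc i) = suc (suc (evens i))
odds  {suc zero}    zero    = zero
odds  {suc (suc d)} zero    = suc zero
odds  {suc (suc d)} (suc i) = suc (suc (odds i))

evens-injective : ∀ {d} {i j : Fin ⌈ d /2⌉} → evens i ≡ evens j → i ≡ j
evens-injective {suc zero}    {zero}  {zero}  _  = refl
evens-injective {suc (suc d)} {zero}  {zero}  _  = refl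
evens-injective {suc (suc d)} {suc i} {suc j} eq =
  cong suc (evens-injective (Finₚ.suc-injective (Finₚ.suc-injective eq)))

halves-cover : ∀ {d} (b : Fin d) → ∃ λ i → evens i ≡ b ⊎ odds i ≡ b
halves-cover {suc zero}    zero          = zero , inj₁ refl
halves-cover {suc (suc d)} zero          = zero , inj₁ refl
halves-cover {suc (suc d)} (suc zero)    = zero , inj₂ refl
halves-cover {suc (suc d)} (suc (suc b)) =
  let i , eq = halves-cover b in suc i , Sum.map (cong +2) (cong +2) eq
  where
  +2 : Fin d → Fin (suc (suc d))
  +2 x = suc (suc x)

theorem3 : (d : ℕ) → 2 ≤ d → DominationNumber d 1 2 (d * ⌈ d /2⌉)
theorem3 d d≥2 =
  (pairWords , pairWords-unique , pairWords-dominating , length-pairWords) ,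
  λ S dominating → ≤-trans (LowerBound.lower-bound (inS? S) (dominating⇒covered S dominating) d≥2)
                            (size≤length S)
  where open Pairing {d} odds evens evens-injective halves-cover
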